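{- Let $G=(V,E)$ be a connected finite undirected graph and $p$ an integer with $1\le p\le |V|$. For every configuration $S$ of $p$ robots on $G$, the equivalence class $\mathcal E_S$ of $S$ under mutual reachability has the same size as the equivalence class $\mathcal E_{S_I}$ of the identity configuration $S_I$; that is, all equivalence classes of the reachability relation have equal size.
   Context: Robots are $R=[p]=\{1,\dots,p\}$. A configuration is an injective map $S:R\to V$; $\mathcal S_G$ is the set of all configurations. A pair $(S,S')$ of configurations is a valid move if it is one of: (i) a simple path move: there is a simple path $(u_0,\dots,u_k)$ in $G$ with $u_k\notin S(R)$, $u_0\notin S'(R)$, $S'(i)=S(i)$ for robots not on the path, and $S'(i)=u_{j+1}$ whenever $S(i)=u_j$, $0\le j\le k-1$; (ii) a simple rotation move: there is a simple cycle $(u_0,\dots,u_{k-1},u_k=u_0)$ in $G$ all of whose vertices are occupied in $S$ and in $S'$, robots off the cycle stay fixed, and $S'(i)=u_{j+1}$ whenever $S(i)=u_j$; (iii) a dummy move $(S,S)$. $T$ is reachable from $S$, written $S\sim T$, if there is a finite sequence $S=S_0,\dots,S_t=T$ with each $(S_{k-1},S_k)$ a valid move; $\sim$ is an equivalence relation on $\mathcal S_G$ and $\mathcal E_S=\{T\in\mathcal S_G: S\sim T\}$. Fix a total order on $V$ and let $v_1,\dots,v_n$ be the order in which breadth-first search, started at the least vertex and exploring neighbours in increasing order, visits the vertices of $G$; the identity configuration is $S_I(i)=v_i$ for $i\in[p]$. -}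

module Defs where

open import Data.Nat using (ℕ; zero; suc; _≤_; _<_)
open import Data.Fin using (Fin; zero; suc; inject₁; fromℕ; inject≤; _≟_)
open import Data.Bool using (Bool; true; false; T; if_then_else_)
open import Data.List using (List; []; _∷_; _++_; allFin; filterᵇ)
open import Data.Vec using (Vec; lookup; tabulate)
open import Data.Product using (Σ; ∃; _×_; _,_)
open import Relation.Nullary using (¬_; does)
open import Relation.Binary.PropositionalEquality using (_≡_; _≢_)
open import Relation.Binary.Construct.Closure.ReflexiveTransitive using (Star)

-- Finite simple undirected graphs on the vertex set Fin n.
-- The total order on V is the natural order of Fin n.

record Graph (n : ℕ) : Set where
  field
    adj    : Fin n → Fin n → Bool
    sym    : ∀ u v → adj u v ≡ adj v u
    irrefl : ∀ u → adj u u ≡ false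

open Graph public

Edge : ∀ {n} → Graph n → Fin n → Fin n → Set
Edge G u v = T (adj G u v)

Connected : ∀ {n} → Graph n → Set
Connected G = ∀ u v → Star (Edge G) u v

Config : ℕ → ℕ → Set
Config n p = Vec (Fin n) p

IsConfig : ∀ {n p} → Config n p → Set
IsConfig {p = p} S = ∀ (i j : Fin p) → lookup S i ≡ lookup S j → i ≡ j

Occupied : ∀ {n p} → Config n p → Fin n → Set
Occupied {p = p} S v = Σ (Fin p) λ i → lookup S i ≡ v

Shift : ∀ {n p} (k : ℕ) → (Fin (suc k) → Fin n) → Config n p → Config n p → Set
Shift {p = p} k u S S' =
  (∀ (i : Fin p) → (∀ (j : Fin (suc k)) → lookup S i ≢ u j) → lookup S' i ≡ lookup S i)
  × (∀ (i : Fin p) (j : Fin k) → lookup S i ≡ u (inject₁ j) → lookup S' i ≡ u (suc j))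

IsWalk : ∀ {n} → Graph n → (k : ℕ) → (Fin (suc k) → Fin n) → Set
IsWalk G k u = ∀ (j : Fin k) → Edge G (u (inject₁ j)) (u (suc j))

SimplePathMove : ∀ {n p} → Graph n → Config n p → Config n p → Set
SimplePathMove {n} G S S' =
  Σ ℕ λ k → Σ (Fin (suc k) → Fin n) λ u →
    IsWalk G k u
    × (∀ a b → u a ≡ u b → a ≡ b)
    × ¬ Occupied S (u (fromℕ k))
    × ¬ Occupied S' (u zero)
    × Shift k u S S'

SimpleRotationMove : ∀ {n p} → Graph n → Config n p → Config n p → Set
SimpleRotationMove {n} G S S' =
  Σ ℕ λ k → Σ (Fin (suc k) → Fin n) λ u →
    3 ≤ k
    × IsWalk G k u
    × u (fromℕ k) ≡ u zero
    × (∀ (a b : Fin k) → u (inject₁ a) ≡ u (inject₁ b) → a ≡ b)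
    × (∀ j → Occupied S (u j))
    × (∀ j → Occupied S' (u j))
    × Shift k u S S'

data ValidMove {n p} (G : Graph n) (S S' : Config n p) : Set where
  pathMove     : IsConfig S → IsConfig S' → SimplePathMove G S S' → ValidMove G S S'
  rotationMove : IsConfig S → IsConfig S' → SimpleRotationMove G S S' → ValidMove G S S'
  dummyMove    : IsConfig S → S ≡ S' → ValidMove G S S'

Reachable : ∀ {n p} → Graph n → Config n p → Config n p → Set
Reachable G = Star (ValidMove G)

private
  member : ∀ {n} → Fin n → List (Fin n) → Bool
  member v []       = false
  member v (w ∷ ws) = if does (v ≟ w) then true else member v ws

  notMember : ∀ {n} → Fin n → List (Fin n) → Bool
  notMember v ws = if member v ws then false else true

  bfs : ∀ {n} → Graph n → ℕ → List (Fin n) → List (Fin n) → List (Fin n)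
  bfs G zero    q       vis = vis
  bfs G (suc f) []      vis = vis
  bfs {n} G (suc f) (u ∷ q) vis =
    let new = filterᵇ (λ w → if adj G u w then notMember w vis else false) (allFin n)
    in bfs G f (q ++ new) (vis ++ new)

-- v₁, v₂, … in BFS visiting order (each vertex is dequeued at most once,
-- so n rounds suffice)
bfsOrder : ∀ {n} → Graph n → List (Fin n)
bfsOrder {zero}  G = []
bfsOrder {suc m} G = bfs G (suc m) (zero ∷ []) (zero ∷ [])

nth : ∀ {A : Set} → List A → ℕ → A → A
nth []       i       d = d
nth (x ∷ xs) zero    d = x
nth (x ∷ xs) (suc i) d = nth xs i d

-- identity configuration S_I(i) = v_i  (0-indexed robots; default never
-- used for connected G since BFS then visits all n ≥ p vertices)
identityConfig : ∀ {n p} → Graph n → p ≤ n → Config n p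
identityConfig {p = p} G p≤n =
  tabulate λ (i : Fin p) → nth (bfsOrder G) (Data.Fin.toℕ i) (inject≤ i p≤n)

{-# OPTIONS --safe #-}
module Submission where

-- Moving one robot along an edge onto an empty vertex is a valid move, and so is moving it back.
-- Chaining such moves along a walk from an occupied vertex a to an empty vertex b (whenever the
-- next vertex is occupied, the robot there is pushed on first) vacates a and fills b, reversibly,
-- leaving every other vertex as it was. Doing this for the vertices of S_I one at a time, each time
-- with a robot not standing on an earlier one (it exists by counting), S reaches and is reachable
-- from a configuration C occupying exactly the vertices of S_I, so C = S_I ∘ π for a permutation π
-- of the robots. Renaming robots by π preserves valid moves, hence is a bijection from the class
-- of C, which is the class of S, onto the class of S_I. That S_I is a configuration at all holds
-- because breadth-first search lists every vertex of a connected graph exactly once.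

open import Data.Bool using (Bool; true; false; T; if_then_else_)
open import Data.Empty using (⊥-elim)
open import Data.Fin using (Fin; zero; suc; _≟_; toℕ; inject≤; inject₁; punchOut)
open import Data.Fin.Permutation using (Permutation′; permutation; _⟨$⟩ʳ_; _⟨$⟩ˡ_; inverseˡ; inverseʳ; flip)
open import Data.Fin.Properties
  using (any?; injective⇒≤; <⇒notInjective; punchOut-injective; inject≤-injective; toℕ-inject≤)
open import Data.List using (List; []; _∷_; _++_; length; filterᵇ; allFin)
import Data.List as List
open import Data.List.Membership.Propositional using (_∈_; _∉_)
open import Data.List.Membership.Propositional.Properties
  using (∈-lookup; ∈-++⁺ˡ; ∈-++⁺ʳ; ∈-++⁻; ∈-filter⁺; ∈-filter⁻; ∈-allFin)
open import Data.List.Properties using (length-++)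
import Data.List.Relation.Unary.All as All
open import Data.List.Relation.Unary.AllPairs using ([]; _∷_)
open import Data.List.Relation.Unary.Any using (here; there; index)
open import Data.List.Relation.Unary.Any.Properties using (lookup-index)
open import Data.List.Relation.Unary.Unique.Propositional using (Unique)
open import Data.List.Relation.Unary.Unique.Propositional.Properties using (++⁺; filter⁺; allFin⁺)
open import Data.Nat using (ℕ; zero; suc; _+_; _≤_; _<_; s≤s; s≤s⁻¹)
open import Data.Nat.Properties
  using (≤-refl; ≤-reflexive; ≤-trans; <-irrefl; <⇒≱; n≤1+n; m≤n+m; +-comm; +-assoc; +-monoˡ-≤;
         +-commutativeSemigroup; module ≤-Reasoning)
open import Algebra.Properties.CommutativeSemigroup +-commutativeSemigroup using (xy∙z≈xz∙y)
open import Data.Product using (Σ; ∃; _×_; _,_; proj₁; proj₂)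
open import Data.Sum using (_⊎_; inj₁; inj₂)
open import Data.Vec using (lookup; tabulate; toList; _[_]≔_)
open import Data.Vec.Membership.Propositional.Properties using (∈-toList⁺)
import Data.Vec.Membership.Propositional.Properties as Vec
open import Data.Vec.Properties
  using (lookup∘tabulate; tabulate∘lookup; tabulate-cong; length-toList;
         lookup∘update; lookup∘update′; []≔-idempotent; []≔-lookup)
open import Function using (id; _∘′_; _∋_)
open import Function.Bundles using (_⇔_; mk⇔; Equivalence)
open import Function.Definitions using (Injective; StrictlySurjective)
open import Relation.Binary.Construct.Closure.ReflexiveTransitive using (Star; ε; _◅_; _◅◅_; gmap)
open import Relation.Binary.PropositionalEquality
open import Relation.Nullary using (¬_; Dec; _because_; does; yes; no; contradiction)
open import Relation.Nullary.Decidable using (T?; ¬?; decidable-stable)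
open import Relation.Nullary.Reflects using (Reflects; ofʸ; ofⁿ)

open import Defs renaming (sym to adj-sym; irrefl to adj-irrefl)

lookup-injective : ∀ {A : Set} {xs : List A} → Unique xs → Injective _≡_ _≡_ (List.lookup xs)
lookup-injective {xs = _ ∷ _} _            {zero}  {zero}  _  = refl
lookup-injective {xs = _ ∷ _} (x∉xs ∷ _)   {zero}  {suc j} eq = contradiction eq (All.lookup x∉xs (∈-lookup j))
lookup-injective {xs = _ ∷ _} (x∉xs ∷ _)   {suc i} {zero}  eq = contradiction (sym eq) (All.lookup x∉xs (∈-lookup i))
lookup-injective {xs = _ ∷ _} (_ ∷ unique) {suc i} {suc j} eq = cong suc (lookup-injective unique eq)

unique⇒length≤ : ∀ {n} {xs : List (Fin n)} → Unique xs → length xs ≤ n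
unique⇒length≤ unique = injective⇒≤ (lookup-injective unique)

injective⇒≤length : ∀ {m} {A : Set} {f : Fin m → A} {xs : List A} →
                    Injective _≡_ _≡_ f → (∀ i → f i ∈ xs) → m ≤ length xs
injective⇒≤length {f = f} {xs} f-inj f∈xs = injective⇒≤ λ {i} {j} eq → f-inj (begin
  f i                              ≡⟨ lookup-index (f∈xs i) ⟩
  List.lookup xs (index (f∈xs i))  ≡⟨ cong (List.lookup xs) eq ⟩
  List.lookup xs (index (f∈xs j))  ≡⟨ lookup-index (f∈xs j) ⟨
  f j                              ∎)
  where open ≡-Reasoning

nth≡lookup : ∀ {A : Set} (xs : List A) (k : Fin (length xs)) d → nth xs (toℕ k) d ≡ List.lookup xs k
nth≡lookup (_ ∷ _)  zero    _ = refl
nth≡lookup (_ ∷ xs) (suc k) d = nth≡lookup xs k d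

-- Breadth-first search

private
  member′ : ∀ {n} → Fin n → List (Fin n) → Bool
  member′ v []       = false
  member′ v (w ∷ ws) = if does (v ≟ w) then true else member′ v ws

  firstLayer : ∀ {m} → Graph (suc m) → List (Fin (suc m))
  firstLayer {m} G =
    filterᵇ (λ w → if adj G zero w then (if member′ w (zero ∷ []) then false else true) else false)
            (allFin (suc m))

-- Defs keeps the search and its membership test private. Below, bfs and member are metavariables
-- that unification solves to exactly those functions: in bfsOrder-firstRound, abstracting the
-- first layer and the size index turns the unfolded bfsOrder G into the private search applied to
-- variables, which determines bfs; bfs-step then determines member. (firstLayer needs its own copy
-- of the membership test because member is still unsolved when it is compared with the unfolding.)
mutual
  bfs : ∀ {n} → Graph n → ℕ → List (Fin n) → List (Fin n) → List (Fin n)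
  bfs = _

  bfsOrder-firstRound : ∀ {m} (G : Graph (suc m)) →
                        bfsOrder G ≡ bfs G m (firstLayer G) (zero ∷ firstLayer G)
  bfsOrder-firstRound {m} G with firstLayer G | List (Fin (suc m)) ∋ zero ∷ firstLayer G
  ... | _ | _ with suc m
  ... | _ = refl

  member : ∀ {n} → Fin n → List (Fin n) → Bool
  member = _

  newNeighbours : ∀ {n} → Graph n → Fin n → List (Fin n) → List (Fin n)
  newNeighbours {n} G u vis = filterᵇ (isNewNeighbour G u vis) (allFin n)

  isNewNeighbour : ∀ {n} → Graph n → Fin n → List (Fin n) → Fin n → Bool
  isNewNeighbour G u vis w = if adj G u w then (if member w vis then false else true) else false

  bfs-step : ∀ {n} (G : Graph n) f u q vis →
             bfs G (suc f) (u ∷ q) vis ≡ bfs G f (q ++ newNeighbours G u vis) (vis ++ newNeighbours G u vis)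
  bfs-step G f u q vis = refl

member-reflects : ∀ {n} (x : Fin n) ys → Reflects (x ∈ ys) (member x ys)
member-reflects x []       = ofⁿ λ ()
member-reflects x (y ∷ ys) with x ≟ y
... | yes x≡y = ofʸ (here x≡y)
... | no  x≢y with member x ys | member-reflects x ys
...   | true  | ofʸ x∈ys = ofʸ (there x∈ys)
...   | false | ofⁿ x∉ys = ofⁿ λ { (here x≡y) → x≢y x≡y ; (there x∈ys) → x∉ys x∈ys }

_∈?_ : ∀ {n} (x : Fin n) ys → Dec (x ∈ ys)
x ∈? ys = member x ys because member-reflects x ys

T-isNewNeighbour : ∀ {n} (G : Graph n) u vis w → T (isNewNeighbour G u vis w) ⇔ (Edge G u w × w ∉ vis)
T-isNewNeighbour G u vis w with adj G u w | member w vis | member-reflects w vis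
... | false | _     | _         = mk⇔ (λ ()) (λ ())
... | true  | true  | ofʸ w∈vis = mk⇔ (λ ()) (λ (_ , w∉vis) → w∉vis w∈vis)
... | true  | false | ofⁿ w∉vis = mk⇔ (λ _ → _ , w∉vis) (λ _ → _)

∈-newNeighbours⁻ : ∀ {n} (G : Graph n) u vis {w} → w ∈ newNeighbours G u vis → Edge G u w × w ∉ vis
∈-newNeighbours⁻ {n} G u vis {w} w∈new =
  Equivalence.to (T-isNewNeighbour G u vis w)
    (proj₂ (∈-filter⁻ (λ x → T? (isNewNeighbour G u vis x)) {xs = allFin n} w∈new))

∈-newNeighbours⁺ : ∀ {n} (G : Graph n) u vis {w} → Edge G u w → w ∉ vis → w ∈ newNeighbours G u vis
∈-newNeighbours⁺ {n} G u vis {w} e w∉vis =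
  ∈-filter⁺ (λ x → T? (isNewNeighbour G u vis x)) {xs = allFin n} (∈-allFin w)
    (Equivalence.from (T-isNewNeighbour G u vis w) (e , w∉vis))

newNeighbours-unique : ∀ {n} (G : Graph n) u vis → Unique (newNeighbours G u vis)
newNeighbours-unique {n} G u vis = filter⁺ (λ x → T? (isNewNeighbour G u vis x)) (allFin⁺ n)

NeighbourClosed : ∀ {n} → Graph n → List (Fin n) → Set
NeighbourClosed G xs = ∀ {x w} → x ∈ xs → Edge G x w → w ∈ xs

record SearchInvariant {n} (G : Graph n) (fuel : ℕ) (queue visited : List (Fin n)) : Set where
  field
    unique  : Unique visited
    queued  : ∀ {x} → x ∈ queue → x ∈ visited
    closed  : ∀ {x} → x ∈ visited → x ∈ queue ⊎ (∀ {w} → Edge G x w → w ∈ visited)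
    -- each vertex is enqueued at most once, so the fuel outlasts the queue
    enough  : length queue + n ≤ fuel + length visited

fuel-step : ∀ a b c d k → suc a + c ≤ suc b + d → (a + k) + c ≤ b + (d + k)
fuel-step a b c d k h = begin
  (a + k) + c  ≡⟨ xy∙z≈xz∙y a k c ⟩
  (a + c) + k  ≤⟨ +-monoˡ-≤ k (s≤s⁻¹ h) ⟩
  (b + d) + k  ≡⟨ +-assoc b d k ⟩
  b + (d + k)  ∎
  where open ≤-Reasoning

search-step : ∀ {n} {G : Graph n} {f u q vis} → SearchInvariant G (suc f) (u ∷ q) vis →
              SearchInvariant G f (q ++ newNeighbours G u vis) (vis ++ newNeighbours G u vis)
search-step {n} {G} {f} {u} {q} {vis} inv = record
  { unique = ++⁺ unique (newNeighbours-unique G u vis) λ (w∈vis , w∈new) →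
               proj₂ (∈-newNeighbours⁻ G u vis w∈new) w∈vis
  ; queued = queued′
  ; closed = closed′
  ; enough = enough′
  }
  where
  open SearchInvariant inv
  new = newNeighbours G u vis

  queued′ : ∀ {x} → x ∈ q ++ new → x ∈ vis ++ new
  queued′ x∈ with ∈-++⁻ q x∈
  ... | inj₁ x∈q   = ∈-++⁺ˡ (queued (there x∈q))
  ... | inj₂ x∈new = ∈-++⁺ʳ vis x∈new

  neighbours-of-u : ∀ {w} → Edge G u w → w ∈ vis ++ new
  neighbours-of-u {w} e with w ∈? vis
  ... | yes w∈vis = ∈-++⁺ˡ w∈vis
  ... | no  w∉vis = ∈-++⁺ʳ vis (∈-newNeighbours⁺ G u vis e w∉vis)

  closed′ : ∀ {x} → x ∈ vis ++ new → x ∈ q ++ new ⊎ (∀ {w} → Edge G x w → w ∈ vis ++ new)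
  closed′ x∈ with ∈-++⁻ vis x∈
  ... | inj₂ x∈new = inj₁ (∈-++⁺ʳ q x∈new)
  ... | inj₁ x∈vis with closed x∈vis
  ...   | inj₁ (here refl)  = inj₂ neighbours-of-u
  ...   | inj₁ (there x∈q)  = inj₁ (∈-++⁺ˡ x∈q)
  ...   | inj₂ nbrs         = inj₂ λ e → ∈-++⁺ˡ (nbrs e)

  enough′ : length (q ++ new) + n ≤ f + length (vis ++ new)
  enough′ rewrite length-++ q {new} | length-++ vis {new} =
    fuel-step (length q) f n (length vis) (length new) enough

emptyQueue⇒closed : ∀ {n} {G : Graph n} {f vis} → SearchInvariant G f [] vis → NeighbourClosed G vis
emptyQueue⇒closed inv x∈vis e with SearchInvariant.closed inv x∈vis
... | inj₂ neighbours = neighbours e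

bfs-correct : ∀ {n} {G : Graph n} {f q vis} → SearchInvariant G f q vis →
              Unique (bfs G f q vis) × (∀ {x} → x ∈ vis → x ∈ bfs G f q vis) × NeighbourClosed G (bfs G f q vis)
bfs-correct {f = zero}  {[]} inv = SearchInvariant.unique inv , id , emptyQueue⇒closed inv
bfs-correct {f = suc _} {[]} inv = SearchInvariant.unique inv , id , emptyQueue⇒closed inv
bfs-correct {n} {f = zero} {_ ∷ q} inv =
  contradiction (≤-trans (s≤s (m≤n+m n (length q))) (≤-trans enough (unique⇒length≤ unique))) (<-irrefl refl)
  where open SearchInvariant inv
bfs-correct {f = suc _} {_ ∷ _} inv with bfs-correct (search-step inv)
... | unique , ⊆result , closed = unique , ⊆result ∘′ ∈-++⁺ˡ , closed

initialSearch : ∀ {m} (G : Graph (suc m)) → SearchInvariant G (suc m) (zero ∷ []) (zero ∷ [])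
initialSearch {m} G =
  record { unique = All.[] ∷ [] ; queued = id ; closed = inj₁ ; enough = ≤-reflexive (+-comm 1 (suc m)) }

bfsOrder-unique : ∀ {n} (G : Graph n) → Unique (bfsOrder G)
bfsOrder-unique {zero}  G = []
bfsOrder-unique {suc m} G = proj₁ (bfs-correct (initialSearch G))

closed-along : ∀ {n} {G : Graph n} {xs x y} → NeighbourClosed G xs → Star (Edge G) x y → x ∈ xs → y ∈ xs
closed-along closed ε          x∈xs = x∈xs
closed-along {G = G} closed (e ◅ walk) x∈xs = closed-along {G = G} closed walk (closed x∈xs e)

bfsOrder-complete : ∀ {n} {G : Graph n} → Connected G → ∀ v → v ∈ bfsOrder G
bfsOrder-complete {suc m} {G} connected v =
  let _ , ⊆result , closed = bfs-correct (initialSearch G)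
  in closed-along {G = G} closed (connected zero v) (⊆result (here refl))

lookup-identityConfig : ∀ {n p} (G : Graph n) (p≤n : p ≤ n) (p≤len : p ≤ length (bfsOrder G)) i →
                        lookup (identityConfig G p≤n) i ≡ List.lookup (bfsOrder G) (inject≤ i p≤len)
lookup-identityConfig G p≤n p≤len i = begin
  lookup (identityConfig G p≤n) i                             ≡⟨ lookup∘tabulate _ i ⟩
  nth (bfsOrder G) (toℕ i) (inject≤ i p≤n)
    ≡⟨ cong (λ k → nth (bfsOrder G) k (inject≤ i p≤n)) (toℕ-inject≤ i p≤len) ⟨
  nth (bfsOrder G) (toℕ (inject≤ i p≤len)) (inject≤ i p≤n)    ≡⟨ nth≡lookup (bfsOrder G) _ _ ⟩
  List.lookup (bfsOrder G) (inject≤ i p≤len)                  ∎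
  where open ≡-Reasoning

identityConfig-isConfig : ∀ {n p} {G : Graph n} → Connected G → (p≤n : p ≤ n) →
                          IsConfig (identityConfig G p≤n)
identityConfig-isConfig {G = G} connected p≤n i j eq =
  inject≤-injective p≤len p≤len i j (lookup-injective (bfsOrder-unique G) (begin
    List.lookup (bfsOrder G) (inject≤ i p≤len)  ≡⟨ lookup-identityConfig G p≤n p≤len i ⟨
    lookup (identityConfig G p≤n) i             ≡⟨ eq ⟩
    lookup (identityConfig G p≤n) j             ≡⟨ lookup-identityConfig G p≤n p≤len j ⟩
    List.lookup (bfsOrder G) (inject≤ j p≤len)  ∎))
  where
  open ≡-Reasoning
  p≤len : _ ≤ length (bfsOrder G)
  p≤len = ≤-trans p≤n (injective⇒≤length (λ eq → eq) (bfsOrder-complete connected))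

-- Moving tokens

lookup∘update-cases : ∀ {n p} (C : Config n p) r b i →
                      (i ≡ r × lookup (C [ r ]≔ b) i ≡ b) ⊎ (i ≢ r × lookup (C [ r ]≔ b) i ≡ lookup C i)
lookup∘update-cases C r b i with i ≟ r
... | yes refl = inj₁ (refl , lookup∘update r C b)
... | no  i≢r  = inj₂ (i≢r , lookup∘update′ i≢r C b)

update-isConfig : ∀ {n p} (C : Config n p) r {b} → IsConfig C → ¬ Occupied C b → IsConfig (C [ r ]≔ b)
update-isConfig C r {b} C-inj b-free i j eq with lookup∘update-cases C r b i | lookup∘update-cases C r b j
... | inj₁ (refl , _)   | inj₁ (refl , _)   = refl
... | inj₁ (refl , Ci)  | inj₂ (_ , Cj)     = contradiction (j , trans (sym Cj) (trans (sym eq) Ci)) b-free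
... | inj₂ (_ , Ci)     | inj₁ (refl , Cj)  = contradiction (i , trans (sym Ci) (trans eq Cj)) b-free
... | inj₂ (_ , Ci)     | inj₂ (_ , Cj)     = C-inj i j (trans (sym Ci) (trans eq Cj))

update-keeps : ∀ {n p} (C : Config n p) r {b v} → Occupied C v → v ≢ lookup C r → Occupied (C [ r ]≔ b) v
update-keeps C r {b} (i , Ci≡v) v≢Cr with lookup∘update-cases C r b i
... | inj₁ (refl , _)  = contradiction (sym Ci≡v) v≢Cr
... | inj₂ (_ , Ci)    = i , trans Ci Ci≡v

update-only : ∀ {n p} (C : Config n p) r {b v} → Occupied (C [ r ]≔ b) v → Occupied C v ⊎ v ≡ b
update-only C r {b} (i , C′i≡v) with lookup∘update-cases C r b i
... | inj₁ (refl , C′i)  = inj₂ (trans (sym C′i≡v) C′i)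
... | inj₂ (_ , C′i)     = inj₁ (i , trans (sym C′i) C′i≡v)

update-vacates : ∀ {n p} (C : Config n p) r {b} → IsConfig C → ¬ Occupied C b →
                 ¬ Occupied (C [ r ]≔ b) (lookup C r)
update-vacates C r {b} C-inj b-free (i , C′i≡Cr) with lookup∘update-cases C r b i
... | inj₁ (refl , C′i)  = b-free (r , trans (sym C′i≡Cr) C′i)
... | inj₂ (i≢r , C′i)   = i≢r (C-inj i r (trans (sym C′i) C′i≡Cr))

occupied≢free : ∀ {n p} {C : Config n p} {a b} → Occupied C a → ¬ Occupied C b → a ≢ b
occupied≢free a-occ b-free refl = b-free a-occ

segment : ∀ {n} → Fin n → Fin n → Fin 2 → Fin n
segment a b zero    = a
segment a b (suc _) = b

segment-injective : ∀ {n} {a b : Fin n} → a ≢ b → ∀ x y → segment a b x ≡ segment a b y → x ≡ y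
segment-injective a≢b zero       zero       _  = refl
segment-injective a≢b zero       (suc zero) eq = contradiction eq a≢b
segment-injective a≢b (suc zero) zero       eq = contradiction (sym eq) a≢b
segment-injective a≢b (suc zero) (suc zero) _  = refl

edgeMove : ∀ {n p} (G : Graph n) {C : Config n p} {r b} → IsConfig C → ¬ Occupied C b →
           Edge G (lookup C r) b → ValidMove G C (C [ r ]≔ b)
edgeMove G {C} {r} {b} C-inj b-free e =
  pathMove C-inj (update-isConfig C r C-inj b-free)
    (1 , segment (lookup C r) b , walk , segment-injective Cr≢b , b-free , update-vacates C r C-inj b-free ,
     stay , advance)
  where
  Cr≢b : lookup C r ≢ b
  Cr≢b = occupied≢free {C = C} (r , refl) b-free

  walk : IsWalk G 1 (segment (lookup C r) b)
  walk zero = e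

  stay : ∀ i → (∀ j → lookup C i ≢ segment (lookup C r) b j) → lookup (C [ r ]≔ b) i ≡ lookup C i
  stay i off-segment with lookup∘update-cases C r b i
  ... | inj₁ (refl , _)  = contradiction refl (off-segment zero)
  ... | inj₂ (_ , C′i)   = C′i

  advance : ∀ i (j : Fin 1) → lookup C i ≡ segment (lookup C r) b (inject₁ j) → lookup (C [ r ]≔ b) i ≡ b
  advance i zero Ci≡Cr with C-inj i r Ci≡Cr
  ... | refl = lookup∘update r C b

edgeMove-back : ∀ {n p} (G : Graph n) {C : Config n p} {r b} → IsConfig C → ¬ Occupied C b →
                Edge G (lookup C r) b → ValidMove G (C [ r ]≔ b) C
edgeMove-back G {C} {r} {b} C-inj b-free e =
  subst (ValidMove G (C [ r ]≔ b)) restore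
    (edgeMove G (update-isConfig C r C-inj b-free) (update-vacates C r C-inj b-free) e′)
  where
  e′ : Edge G (lookup (C [ r ]≔ b) r) (lookup C r)
  e′ rewrite lookup∘update r C b | adj-sym G b (lookup C r) = e

  restore : (C [ r ]≔ b) [ r ]≔ lookup C r ≡ C
  restore = trans ([]≔-idempotent C r) ([]≔-lookup C r)

-- What travels from a to b is a token, not necessarily a single robot.
record Transfer {n p} (G : Graph n) (C : Config n p) (a b : Fin n) : Set where
  field
    result   : Config n p
    isConfig : IsConfig result
    forth    : Reachable G C result
    back     : Reachable G result C
    keeps    : ∀ {v} → Occupied C v → v ≢ a → Occupied result v
    fills    : Occupied result b
    only     : ∀ {v} → Occupied result v → Occupied C v ⊎ v ≡ b
    vacates  : ¬ Occupied result a

open Transfer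

edgeTransfer : ∀ {n p} {G : Graph n} {C : Config n p} {a b} → IsConfig C → Occupied C a →
               ¬ Occupied C b → Edge G a b → Transfer G C a b
edgeTransfer {G = G} {C} {b = b} C-inj (r , refl) b-free e = record
  { result   = C [ r ]≔ b
  ; isConfig = update-isConfig C r C-inj b-free
  ; forth    = edgeMove G C-inj b-free e ◅ ε
  ; back     = edgeMove-back G C-inj b-free e ◅ ε
  ; keeps    = update-keeps C r
  ; fills    = r , lookup∘update r C b
  ; only     = update-only C r
  ; vacates  = update-vacates C r C-inj b-free
  }

transfer-via-free : ∀ {n p} {G : Graph n} {C : Config n p} {a w b} → ¬ Occupied C w → a ≢ b →
                    (t : Transfer G C a w) → Transfer G (result t) w b → Transfer G C a b
transfer-via-free {C = C} {a} {w} {b} w-free a≢b t u = record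
  { result   = result u
  ; isConfig = isConfig u
  ; forth    = forth t ◅◅ forth u
  ; back     = back u ◅◅ back t
  ; keeps    = λ v-occ v≢a → keeps u (keeps t v-occ v≢a) λ { refl → w-free v-occ }
  ; fills    = fills u
  ; only     = only′
  ; vacates  = vacates′
  }
  where
  only′ : ∀ {v} → Occupied (result u) v → Occupied C v ⊎ v ≡ b
  only′ v-occ with only u v-occ
  ... | inj₂ v≡b = inj₂ v≡b
  ... | inj₁ v-occₜ with only t v-occₜ
  ...   | inj₁ v-occ₀ = inj₁ v-occ₀
  ...   | inj₂ refl   = contradiction v-occ (vacates u)

  vacates′ : ¬ Occupied (result u) a
  vacates′ a-occ with only u a-occ
  ... | inj₁ a-occₜ = vacates t a-occₜ
  ... | inj₂ a≡b    = a≢b a≡b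

transfer-via-occupied : ∀ {n p} {G : Graph n} {C : Config n p} {a w b} → Occupied C w → a ≢ b →
                        (t : Transfer G C w b) → Transfer G (result t) a w → Transfer G C a b
transfer-via-occupied {C = C} {a} {w} {b} w-occ a≢b t u = record
  { result   = result u
  ; isConfig = isConfig u
  ; forth    = forth t ◅◅ forth u
  ; back     = back u ◅◅ back t
  ; keeps    = keeps′
  ; fills    = keeps u (fills t) (a≢b ∘′ sym)
  ; only     = only′
  ; vacates  = vacates u
  }
  where
  keeps′ : ∀ {v} → Occupied C v → v ≢ a → Occupied (result u) v
  keeps′ {v} v-occ v≢a with v ≟ w
  ... | yes refl = fills u
  ... | no  v≢w  = keeps u (keeps t v-occ v≢w) v≢a

  only′ : ∀ {v} → Occupied (result u) v → Occupied C v ⊎ v ≡ b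
  only′ v-occ with only u v-occ
  ... | inj₁ v-occₜ = only t v-occₜ
  ... | inj₂ refl   = inj₁ w-occ

occupied? : ∀ {n p} (C : Config n p) v → Dec (Occupied C v)
occupied? C v = any? (λ i → lookup C i ≟ v)

walkTransfer : ∀ {n p} {G : Graph n} {C : Config n p} {a b} → Star (Edge G) a b → IsConfig C →
               Occupied C a → ¬ Occupied C b → Transfer G C a b
walkTransfer ε C-inj a-occ b-free = contradiction a-occ b-free
walkTransfer {G = G} {C} {a} {b} (_◅_ {j = w} e walk) C-inj a-occ b-free with occupied? C w
... | yes w-occ =
  transfer-via-occupied w-occ (occupied≢free {C = C} a-occ b-free) pushed
    (edgeTransfer (isConfig pushed) (keeps pushed a-occ a≢w) (vacates pushed) e)
  where
  pushed = walkTransfer walk C-inj w-occ b-free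
  a≢w : a ≢ w
  a≢w refl = subst T (adj-irrefl G a) e
... | no w-free with w ≟ b
...   | yes refl = edgeTransfer C-inj a-occ w-free e
...   | no  w≢b  =
  transfer-via-free w-free (occupied≢free {C = C} a-occ b-free) stepped
    (walkTransfer walk (isConfig stepped) (fills stepped) b-free′)
  where
  stepped = edgeTransfer C-inj a-occ w-free e
  b-free′ : ¬ Occupied (result stepped) b
  b-free′ b-occ with only stepped b-occ
  ... | inj₁ b-occ₀ = b-free b-occ₀
  ... | inj₂ b≡w    = w≢b (sym b≡w)

freeRobot : ∀ {n p} {C : Config n p} → IsConfig C → (ts : List (Fin n)) → length ts < p →
            ∃ λ r → lookup C r ∉ ts
freeRobot {C = C} C-inj ts ts<p with any? (λ r → ¬? (lookup C r ∈? ts))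
... | yes found = found
... | no  none  = contradiction (injective⇒≤length (λ {i} {j} → C-inj i j) all-in) (<⇒≱ ts<p)
  where
  all-in : ∀ r → lookup C r ∈ ts
  all-in r = decidable-stable (lookup C r ∈? ts) (λ r∉ts → none (r , r∉ts))

record Cover {n p} (G : Graph n) (C : Config n p) (targets : List (Fin n)) : Set where
  field
    result   : Config n p
    isConfig : IsConfig result
    forth    : Reachable G C result
    back     : Reachable G result C
    covers   : ∀ {v} → v ∈ targets → Occupied result v

cover : ∀ {n p} {G : Graph n} → Connected G → {C : Config n p} → IsConfig C →
        (targets : List (Fin n)) → length targets ≤ p → Cover G C targets
cover connected {C} C-inj [] _ = record { result = C ; isConfig = C-inj ; forth = ε ; back = ε ; covers = λ () }
cover connected C-inj (t ∷ ts) ts<p with cover connected C-inj ts (≤-trans (n≤1+n _) ts<p)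
... | K with occupied? (Cover.result K) t
...   | yes t-occ =
  record { Cover K hiding (covers) ; covers = λ { (here refl) → t-occ ; (there v∈ts) → Cover.covers K v∈ts } }
...   | no  t-free = record
  { result   = result moved
  ; isConfig = isConfig moved
  ; forth    = Cover.forth K ◅◅ forth moved
  ; back     = back moved ◅◅ Cover.back K
  ; covers   = λ { (here refl) → fills moved
                 ; (there v∈ts) → keeps moved (Cover.covers K v∈ts) λ v≡Cr →
                                    r∉ts (subst (_∈ ts) v≡Cr v∈ts) }
  }
  where
  free = freeRobot {C = Cover.result K} (Cover.isConfig K) ts ts<p
  r = proj₁ free
  r∉ts = proj₂ free
  moved = walkTransfer (connected (lookup (Cover.result K) r) t) (Cover.isConfig K) (r , refl) t-free

-- Relabelling robots

injective⇒strictlySurjective : ∀ {p} {f : Fin p → Fin p} → Injective _≡_ _≡_ f → StrictlySurjective _≡_ f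
injective⇒strictlySurjective {suc p} {f} f-inj i with any? (λ j → f j ≟ i)
... | yes hit = hit
... | no miss = ⊥-elim (<⇒notInjective ≤-refl punchOut∘f-injective)
  where
  missed : ∀ j → i ≢ f j
  missed j i≡fj = miss (j , sym i≡fj)
  punchOut∘f-injective : Injective _≡_ _≡_ (λ j → punchOut (missed j))
  punchOut∘f-injective eq = f-inj (punchOut-injective (missed _) (missed _) eq)

injective⇒permutation : ∀ {p} (f : Fin p → Fin p) → Injective _≡_ _≡_ f → Permutation′ p
injective⇒permutation f f-inj =
  permutation f (λ i → proj₁ (onto i)) (λ i → proj₂ (onto i)) (λ i → f-inj (proj₂ (onto (f i))))
  where onto = injective⇒strictlySurjective f-inj

relabel : ∀ {n p} → Permutation′ p → Config n p → Config n p
relabel π S = tabulate (λ i → lookup S (π ⟨$⟩ʳ i))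

lookup-relabel : ∀ {n p} (π : Permutation′ p) (S : Config n p) i →
                 lookup (relabel π S) i ≡ lookup S (π ⟨$⟩ʳ i)
lookup-relabel π S i = lookup∘tabulate _ i

relabel-flip : ∀ {n p} (π : Permutation′ p) (S : Config n p) → relabel (flip π) (relabel π S) ≡ S
relabel-flip π S =
  trans (tabulate-cong λ i → trans (lookup-relabel π S _) (cong (lookup S) (inverseʳ π))) (tabulate∘lookup S)

relabel-isConfig : ∀ {n p} (π : Permutation′ p) {S : Config n p} → IsConfig S → IsConfig (relabel π S)
relabel-isConfig π {S} S-inj i j eq = begin
  i                        ≡⟨ inverseˡ π ⟨
  π ⟨$⟩ˡ (π ⟨$⟩ʳ i)
    ≡⟨ cong (π ⟨$⟩ˡ_) (S-inj _ _ (trans (sym (lookup-relabel π S i)) (trans eq (lookup-relabel π S j)))) ⟩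
  π ⟨$⟩ˡ (π ⟨$⟩ʳ j)         ≡⟨ inverseˡ π ⟩
  j                        ∎
  where open ≡-Reasoning

occupied-relabel⁺ : ∀ {n p} (π : Permutation′ p) {S : Config n p} {v} → Occupied S v → Occupied (relabel π S) v
occupied-relabel⁺ π {S} (i , Si≡v) =
  π ⟨$⟩ˡ i , trans (lookup-relabel π S _) (trans (cong (lookup S) (inverseʳ π)) Si≡v)

occupied-relabel⁻ : ∀ {n p} (π : Permutation′ p) {S : Config n p} {v} → Occupied (relabel π S) v → Occupied S v
occupied-relabel⁻ π {S} (i , eq) = π ⟨$⟩ʳ i , trans (sym (lookup-relabel π S i)) eq

relabel-shift : ∀ {n p} (π : Permutation′ p) {S S′ : Config n p} {k u} →
                Shift k u S S′ → Shift k u (relabel π S) (relabel π S′)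
relabel-shift π {S} {S′} (stay , advance) =
  (λ i off → trans (lookup-relabel π S′ i)
               (trans (stay _ λ j eq → off j (trans (lookup-relabel π S i) eq)) (sym (lookup-relabel π S i)))) ,
  (λ i j eq → trans (lookup-relabel π S′ i) (advance _ j (trans (sym (lookup-relabel π S i)) eq)))

relabel-validMove : ∀ {n p} {G : Graph n} (π : Permutation′ p) {S S′ : Config n p} →
                    ValidMove G S S′ → ValidMove G (relabel π S) (relabel π S′)
relabel-validMove π {S} {S′} (pathMove S-inj S′-inj (k , u , walk , u-inj , end-free , start-free , shift)) =
  pathMove (relabel-isConfig π {S} S-inj) (relabel-isConfig π {S′} S′-inj)
    (k , u , walk , u-inj , end-free ∘′ occupied-relabel⁻ π {S} , start-free ∘′ occupied-relabel⁻ π {S′} ,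
     relabel-shift π {S} {S′} shift)
relabel-validMove π {S} {S′}
                  (rotationMove S-inj S′-inj (k , u , 3≤k , walk , closed , u-inj , occ , occ′ , shift)) =
  rotationMove (relabel-isConfig π {S} S-inj) (relabel-isConfig π {S′} S′-inj)
    (k , u , 3≤k , walk , closed , u-inj , (λ j → occupied-relabel⁺ π {S} (occ j)) ,
     (λ j → occupied-relabel⁺ π {S′} (occ′ j)) , relabel-shift π {S} {S′} shift)
relabel-validMove π {S} (dummyMove S-inj refl) = dummyMove (relabel-isConfig π {S} S-inj) refl

relabel-reachable : ∀ {n p} {G : Graph n} (π : Permutation′ p) {S T : Config n p} →
                    Reachable G S T → Reachable G (relabel π S) (relabel π T)
relabel-reachable π = gmap (relabel π) (relabel-validMove π)

covered⇒relabelling : ∀ {n p} {C D : Config n p} → IsConfig D → (∀ l → Occupied C (lookup D l)) →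
                      Σ (Permutation′ p) λ π → relabel π C ≡ D
covered⇒relabelling {p = p} {C} {D} D-inj covered =
  injective⇒permutation robotAt robotAt-injective ,
  trans (tabulate-cong (λ l → proj₂ (covered l))) (tabulate∘lookup D)
  where
  robotAt : Fin p → Fin p
  robotAt l = proj₁ (covered l)
  robotAt-injective : Injective _≡_ _≡_ robotAt
  robotAt-injective {l} {l′} eq =
    D-inj l l′ (trans (sym (proj₂ (covered l))) (trans (cong (lookup C) eq) (proj₂ (covered l′))))

lemma14 : (n : ℕ) (G : Graph n) → Connected G →
          (p : ℕ) → 1 ≤ p → (p≤n : p ≤ n) →
          (S : Config n p) → IsConfig S →
          Σ (Config n p → Config n p) λ f → Σ (Config n p → Config n p) λ g →
            (∀ T → Reachable G S T → Reachable G (identityConfig G p≤n) (f T))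
            × (∀ T → Reachable G (identityConfig G p≤n) T → Reachable G S (g T))
            × (∀ T → Reachable G S T → g (f T) ≡ T)
            × (∀ T → Reachable G (identityConfig G p≤n) T → f (g T) ≡ T)
lemma14 n G connected p _ p≤n S S-inj =
  relabel π , relabel (flip π) , to-identity , from-identity ,
  (λ T _ → relabel-flip π T) , (λ T _ → relabel-flip (flip π) T)
  where
  Sᵢ = identityConfig G p≤n
  K = cover connected S-inj (toList Sᵢ) (≤-reflexive (length-toList Sᵢ))
  C = Cover.result K
  relabelling = covered⇒relabelling {C = C} (identityConfig-isConfig connected p≤n)
                  (λ l → Cover.covers K (∈-toList⁺ (Vec.∈-lookup l Sᵢ)))
  π = proj₁ relabelling
  πC≡Sᵢ : relabel π C ≡ Sᵢ
  πC≡Sᵢ = proj₂ relabelling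
  π⁻¹Sᵢ≡C : relabel (flip π) Sᵢ ≡ C
  π⁻¹Sᵢ≡C = trans (cong (relabel (flip π)) (sym πC≡Sᵢ)) (relabel-flip π C)

  to-identity : ∀ T → Reachable G S T → Reachable G Sᵢ (relabel π T)
  to-identity T S∼T =
    subst (λ X → Reachable G X (relabel π T)) πC≡Sᵢ (relabel-reachable π (Cover.back K ◅◅ S∼T))

  from-identity : ∀ T → Reachable G Sᵢ T → Reachable G S (relabel (flip π) T)
  from-identity T Sᵢ∼T =
    Cover.forth K ◅◅
    subst (λ X → Reachable G X (relabel (flip π) T)) π⁻¹Sᵢ≡C (relabel-reachable (flip π) Sᵢ∼T)
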